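{- Consider the threshold-perturbed proportional allocation algorithm (described in the context) run for $\tau\ge1$ rounds on an allocation instance $(G=(L\cup R,E),\mathsf{C})$, with $\epsilon\in(0,1/4]$, and with parameters $k_{v,r}$ satisfying $\frac1k\le k_{v,r}\le k$ for all $v\in R$, $1\le r\le\tau$, for some number $k$ with $\epsilon\le\frac1k$. After all rounds have completed: (1) for every $v\in\bigcup_{j=0}^{2\tau-1}\mathcal{L}_j$, $\mathsf{alloc}_v\ge\frac{1}{1+(k+2)\epsilon}\mathsf{C}_v$; and (2) for every $v\in\bigcup_{j=1}^{2\tau}\mathcal{L}_j$, $\mathsf{alloc}_v\le(1+(k+2)\epsilon)\mathsf{C}_v$.
   Context: Allocation instance: bipartite graph $G=(L\cup R,E)$, integer capacities $\mathsf{C}_v\ge1$ for $v\in R$; $\mathsf{N}_w$ is the neighborhood of $w$. Threshold-perturbed proportional allocation algorithm with inputs $\tau\ge1$, $\epsilon\in(0,1/4]$ and positive reals $\{k_{v,r}\}_{v\in R,1\le r\le\tau}$: initially $\beta_v=1$ for all $v\in R$. For rounds $r=1,\dots,\tau$: (a) every $u\in L$ sets $\mathsf{x}_{u,v}=\beta_v/\sum_{v'\in\mathsf{N}_u}\beta_{v'}$ for $v\in\mathsf{N}_u$; (b) every $v\in R$ sets $\mathsf{alloc}_v=\sum_{u\in\mathsf{N}_v}\mathsf{x}_{u,v}$; (c) every $v\in R$ updates $\beta_v\leftarrow\beta_v(1+\epsilon)$ if $\mathsf{alloc}_v\le\mathsf{C}_v/(1+k_{v,r}\epsilon)$, $\beta_v\leftarrow\beta_v/(1+\epsilon)$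 if $\mathsf{alloc}_v\ge\mathsf{C}_v(1+k_{v,r}\epsilon)$, unchanged otherwise. Afterwards $\mathsf{x}'_{u,v}=\frac{\mathsf{C}_v}{\mathsf{alloc}_v}\mathsf{x}_{u,v}$ if $\mathsf{alloc}_v>\mathsf{C}_v$, else $\mathsf{x}'_{u,v}=\mathsf{x}_{u,v}$. After completion, $\mathsf{x}$ and $\mathsf{alloc}$ denote the values computed in round $\tau$ and $\beta_v$ the values after round $\tau$'s update. Level sets: for $0\le j\le2\tau$, $\mathcal{L}_j=\{v\in R:\beta_v=(1+\epsilon)^{j-\tau}\}$.
   Formalization: The parameters ε, k and $k_{v,r}$ are rational numbers rather than real ones. -}

module Defs where

open import Data.Bool using (Bool; true; false; if_then_else_)
open import Data.Nat as ℕ using (ℕ; zero; suc)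
open import Data.Fin using (Fin)
open import Data.List using (List; map; foldr; filterᵇ; allFin)
open import Data.Integer using (+_)
open import Data.Rational
  using (ℚ; 0ℚ; 1ℚ; _+_; _*_; _≤_; 1/_; ≢-nonZero)
open import Data.Rational.Properties using (_≟_; _≤?_)
open import Relation.Nullary using (yes; no)
open import Relation.Binary.PropositionalEquality using (_≡_)

-- Total reciprocal on ℚ: 1/q for q ≠ 0, and (arbitrarily) 0 for q = 0.
-- It is only ever applied to strictly positive quantities in the
-- statement / algorithm, so the junk value is never relevant.
inv : ℚ → ℚ
inv q with q ≟ 0ℚ
... | yes _ = 0ℚ
... | no q≢0 = 1/_ q {{≢-nonZero q≢0}}

ι : ℕ → ℚ
ι n = (+ n) Data.Rational./ 1

_^_ : ℚ → ℕ → ℚ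
q ^ zero = 1ℚ
q ^ suc n = q * (q ^ n)

sumℚ : List ℚ → ℚ
sumℚ = foldr _+_ 0ℚ

record Instance : Set where
  field
    nL nR : ℕ
    E     : Fin nL → Fin nR → Bool
    C     : Fin nR → ℕ

module _ (I : Instance) where
  open Instance I

  NL : Fin nL → List (Fin nR)
  NL u = filterᵇ (λ v → E u v) (allFin nR)

  NR : Fin nR → List (Fin nL)
  NR v = filterᵇ (λ u → E u v) (allFin nL)

  xval : (Fin nR → ℚ) → Fin nL → Fin nR → ℚ
  xval β u v = β v * inv (sumℚ (map β (NL u)))

  allocOf : (Fin nR → ℚ) → Fin nR → ℚ
  allocOf β v = sumℚ (map (λ u → xval β u v) (NR v))

  update : (ε : ℚ) (kp : Fin nR → ℕ → ℚ) (r : ℕ) → (Fin nR → ℚ) → Fin nR → ℚ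
  update ε kp r β v with allocOf β v ≤? (ι (C v) * inv (1ℚ + kp v r * ε))
  ... | yes _ = β v * (1ℚ + ε)
  ... | no _ with (ι (C v) * (1ℚ + kp v r * ε)) ≤? allocOf β v
  ...   | yes _ = β v * inv (1ℚ + ε)
  ...   | no _  = β v

  βAfter : (ε : ℚ) (kp : Fin nR → ℕ → ℚ) → ℕ → Fin nR → ℚ
  βAfter ε kp zero v = 1ℚ
  βAfter ε kp (suc r) = update ε kp (suc r) (βAfter ε kp r)

  -- alloc_v as computed in round r (≥ 1): uses β after round r-1
  allocRound : (ε : ℚ) (kp : Fin nR → ℕ → ℚ) → ℕ → Fin nR → ℚ
  allocRound ε kp r = allocOf (βAfter ε kp (r ℕ.∸ 1))

  xRound : (ε : ℚ) (kp : Fin nR → ℕ → ℚ) → ℕ → Fin nL → Fin nR → ℚ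
  xRound ε kp r = xval (βAfter ε kp (r ℕ.∸ 1))

  -- level sets after τ rounds: v ∈ L_j iff β_v = (1+ε)^(j-τ)
  -- (integer exponent j - τ written as (1+ε)^j / (1+ε)^τ)
  InLevel : (ε : ℚ) (kp : Fin nR → ℕ → ℚ) (τ j : ℕ) → Fin nR → Set
  InLevel ε kp τ j v =
    βAfter ε kp τ v ≡ ((1ℚ + ε) ^ j) * inv ((1ℚ + ε) ^ τ)

{-# OPTIONS --safe #-}

-- A round scales every weight β_w by (1+ε), by 1/(1+ε) or by 1, so every share
-- x_{u,v} = β_v / Σ_{w ∈ N_u} β_w, and with it alloc_v, changes by a factor of at most (1+ε)²,
-- of at most 1+ε when β_v is kept, and not at all in the wrong direction when β_v is raised
-- (lowered).  Hence, by induction over the rounds, once some round has not raised β_v the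
-- allocation stays ≥ C_v/(1+(k+2)ε): a round that does not raise β_v certifies
-- alloc_v > C_v/(1+k_{v,r}ε), and both (1+ε)(1+kε) and (1+ε)² are ≤ 1+(k+2)ε because kε ≤ 1
-- and ε ≤ k.  A vertex outside L_{2τ} was not raised in every round, so the allocation of
-- round τ obeys the lower bound, by round τ's own test or by the invariant before it.  The
-- upper bound is the mirror image, with level L_0 (lowered in every round) excluded.

module Submission where

open import Defs
open import Data.Nat as ℕ using (ℕ; zero; suc)
import Data.Nat.Properties as ℕₚ
open import Data.Fin using (Fin)
open import Data.Product using (_×_; _,_; proj₁; proj₂)
open import Data.Sum using (_⊎_; inj₁; inj₂)
open import Data.Empty using (⊥-elim)
open import Data.List using (List; []; _∷_; map)
open import Data.Integer using (+_)
open import Data.Rational using (ℚ; 0ℚ; 1ℚ; _+_; _*_; _≤_; _<_; _/_; 1/_; positive; nonNegative)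
import Data.Rational.Properties as ℚ
open import Data.Rational.Solver using (module +-*-Solver)
open import Relation.Nullary using (yes; no)
open import Relation.Binary.Definitions using (tri<; tri≈; tri>)
open import Relation.Binary.PropositionalEquality

open +-*-Solver using (solve; _:=_; _:*_; _:+_; con)
open ℚ.≤-Reasoning

0<1 : 0ℚ < 1ℚ
0<1 = ℚ.positive⁻¹ 1ℚ

*-monoˡ-≤-nonNeg′ : ∀ {r p q} → 0ℚ ≤ r → p ≤ q → r * p ≤ r * q
*-monoˡ-≤-nonNeg′ {r} 0≤r = ℚ.*-monoˡ-≤-nonNeg r {{nonNegative 0≤r}}

*-monoʳ-≤-nonNeg′ : ∀ {r p q} → 0ℚ ≤ r → p ≤ q → p * r ≤ q * r
*-monoʳ-≤-nonNeg′ {r} 0≤r = ℚ.*-monoʳ-≤-nonNeg r {{nonNegative 0≤r}}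

*-nonNeg : ∀ {p q} → 0ℚ ≤ p → 0ℚ ≤ q → 0ℚ ≤ p * q
*-nonNeg {p} {q} 0≤p 0≤q = subst (_≤ p * q) (ℚ.*-zeroʳ p) (*-monoˡ-≤-nonNeg′ 0≤p 0≤q)

*-pos : ∀ {p q} → 0ℚ < p → 0ℚ < q → 0ℚ < p * q
*-pos {p} {q} 0<p 0<q = ℚ.positive⁻¹ (p * q) {{ℚ.pos*pos⇒pos p {{positive 0<p}} q {{positive 0<q}}}}

1≤1+ : ∀ {x} → 0ℚ ≤ x → 1ℚ ≤ 1ℚ + x
1≤1+ {x} 0≤x = subst (_≤ 1ℚ + x) (ℚ.+-identityʳ 1ℚ) (ℚ.+-monoʳ-≤ 1ℚ 0≤x)

1<1+ : ∀ {x} → 0ℚ < x → 1ℚ < 1ℚ + x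
1<1+ {x} 0<x = subst (_< 1ℚ + x) (ℚ.+-identityʳ 1ℚ) (ℚ.+-monoʳ-< 1ℚ 0<x)

≤-*-of-1≤ : ∀ {r x} → 1ℚ ≤ r → 0ℚ ≤ x → x ≤ r * x
≤-*-of-1≤ {r} {x} 1≤r 0≤x = subst (_≤ r * x) (ℚ.*-identityˡ x) (*-monoʳ-≤-nonNeg′ 0≤x 1≤r)

inv-≡-1/ : ∀ {x} (0<x : 0ℚ < x) → inv x ≡ (1/ x) {{ℚ.pos⇒nonZero x {{positive 0<x}}}}
inv-≡-1/ {x} 0<x with x ℚ.≟ 0ℚ
... | yes x≡0 = ⊥-elim (ℚ.<-irrefl (sym x≡0) 0<x)
... | no _ = refl

inv-pos : ∀ {x} → 0ℚ < x → 0ℚ < inv x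
inv-pos {x} 0<x rewrite inv-≡-1/ 0<x = ℚ.positive⁻¹ _ {{ℚ.1/pos⇒pos x {{positive 0<x}}}}

inv-inverseʳ : ∀ {x} → 0ℚ < x → x * inv x ≡ 1ℚ
inv-inverseʳ {x} 0<x rewrite inv-≡-1/ 0<x = ℚ.*-inverseʳ x {{ℚ.pos⇒nonZero x {{positive 0<x}}}}

inv-inverseˡ : ∀ {x} → 0ℚ < x → inv x * x ≡ 1ℚ
inv-inverseˡ {x} 0<x = trans (ℚ.*-comm (inv x) x) (inv-inverseʳ 0<x)

*-inv-cancel : ∀ {p} x → 0ℚ < p → p * (x * inv p) ≡ x
*-inv-cancel {p} x 0<p =
  trans (solve 3 (λ p x p⁻¹ → p :* (x :* p⁻¹) := x :* (p :* p⁻¹)) refl p x (inv p))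
        (trans (cong (x *_) (inv-inverseʳ 0<p)) (ℚ.*-identityʳ x))

inv-*-cancel : ∀ {p} x → 0ℚ < p → inv p * (x * p) ≡ x
inv-*-cancel {p} x 0<p =
  trans (solve 3 (λ p x p⁻¹ → p⁻¹ :* (x :* p) := x :* (p :* p⁻¹)) refl p x (inv p))
        (trans (cong (x *_) (inv-inverseʳ 0<p)) (ℚ.*-identityʳ x))

inv-antimono : ∀ {a x y} → 0ℚ < x → 0ℚ < y → x ≤ a * y → inv y ≤ a * inv x
inv-antimono {a} {x} {y} 0<x 0<y x≤ay = begin
  inv y                     ≡⟨ sym (inv-*-cancel (inv y) 0<x) ⟩
  inv x * (inv y * x)       ≤⟨ *-monoˡ-≤-nonNeg′ (ℚ.<⇒≤ (inv-pos 0<x))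
                                 (*-monoˡ-≤-nonNeg′ (ℚ.<⇒≤ (inv-pos 0<y)) x≤ay) ⟩
  inv x * (inv y * (a * y)) ≡⟨ cong (inv x *_) (trans (ℚ.*-comm (inv y) (a * y))
                                                      (ℚ.*-assoc a y (inv y))) ⟩
  inv x * (a * (y * inv y)) ≡⟨ cong (λ z → inv x * (a * z)) (inv-inverseʳ 0<y) ⟩
  inv x * (a * 1ℚ)          ≡⟨ trans (cong (inv x *_) (ℚ.*-identityʳ a)) (ℚ.*-comm (inv x) a) ⟩
  a * inv x                 ∎

inv≤1 : ∀ {x} → 1ℚ ≤ x → inv x ≤ 1ℚ
inv≤1 {x} 1≤x = inv-antimono 0<1 (ℚ.<-≤-trans 0<1 1≤x) (subst (1ℚ ≤_) (sym (ℚ.*-identityˡ x)) 1≤x)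

*-inv-<⇒≤-* : ∀ {p c a} → 0ℚ < p → c * inv p < a → c ≤ p * a
*-inv-<⇒≤-* {p} {c} {a} 0<p c/p<a = begin
  c                ≡⟨ sym (*-inv-cancel c 0<p) ⟩
  p * (c * inv p)  ≤⟨ *-monoˡ-≤-nonNeg′ (ℚ.<⇒≤ 0<p) (ℚ.<⇒≤ c/p<a) ⟩
  p * a            ∎

≤-*⇒inv-*≤ : ∀ {d c a} → 0ℚ < d → c ≤ d * a → inv d * c ≤ a
≤-*⇒inv-*≤ {d} {c} {a} 0<d c≤da = begin
  inv d * c        ≤⟨ *-monoˡ-≤-nonNeg′ (ℚ.<⇒≤ (inv-pos 0<d)) c≤da ⟩
  inv d * (d * a)  ≡⟨ cong (inv d *_) (ℚ.*-comm d a) ⟩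
  inv d * (a * d)  ≡⟨ inv-*-cancel a 0<d ⟩
  a                ∎

module _ {A : Set} where

  sumℚ-≤-scaled : ∀ {f g : A → ℚ} {c} xs → (∀ x → f x ≤ c * g x) →
                  sumℚ (map f xs) ≤ c * sumℚ (map g xs)
  sumℚ-≤-scaled {c = c} [] _ = ℚ.≤-reflexive (sym (ℚ.*-zeroʳ c))
  sumℚ-≤-scaled {f} {g} {c} (x ∷ xs) f≤cg = begin
    f x + sumℚ (map f xs)          ≤⟨ ℚ.+-mono-≤ (f≤cg x) (sumℚ-≤-scaled {f} {g} {c} xs f≤cg) ⟩
    c * g x + c * sumℚ (map g xs)  ≡⟨ sym (ℚ.*-distribˡ-+ c (g x) _) ⟩
    c * sumℚ (map g (x ∷ xs))      ∎

  sumℚ-nonNeg : ∀ {f : A → ℚ} xs → (∀ x → 0ℚ ≤ f x) → 0ℚ ≤ sumℚ (map f xs)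
  sumℚ-nonNeg [] _ = ℚ.≤-refl
  sumℚ-nonNeg (x ∷ xs) f≥0 = ℚ.+-mono-≤ (f≥0 x) (sumℚ-nonNeg xs f≥0)

  sumℚ-pos : ∀ {f : A → ℚ} x xs → (∀ y → 0ℚ < f y) → 0ℚ < sumℚ (map f (x ∷ xs))
  sumℚ-pos x xs f>0 = ℚ.+-mono-<-≤ (f>0 x) (sumℚ-nonNeg xs (λ y → ℚ.<⇒≤ (f>0 y)))

module _ {A : Set} {β : A → ℚ} (β-pos : ∀ w → 0ℚ < β w) where

  share-nonNeg : ∀ v ws → 0ℚ ≤ β v * inv (sumℚ (map β ws))
  share-nonNeg v [] = ℚ.≤-reflexive (sym (ℚ.*-zeroʳ (β v)))
  share-nonNeg v (w ∷ ws) = *-nonNeg (ℚ.<⇒≤ (β-pos v)) (ℚ.<⇒≤ (inv-pos (sumℚ-pos w ws β-pos)))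

  share-≤ : ∀ {β′ : A → ℚ} {a b v} → (∀ w → 0ℚ < β′ w) → 0ℚ ≤ b →
            (∀ w → β′ w ≤ a * β w) → β v ≤ b * β′ v → ∀ ws →
            β v * inv (sumℚ (map β ws)) ≤ b * a * (β′ v * inv (sumℚ (map β′ ws)))
  share-≤ {β′} {a} {b} {v} _ _ _ _ [] = ℚ.≤-reflexive (begin-equality
    β v * 0ℚ              ≡⟨ ℚ.*-zeroʳ (β v) ⟩
    0ℚ                    ≡⟨ sym (ℚ.*-zeroʳ (b * a)) ⟩
    b * a * 0ℚ            ≡⟨ cong (b * a *_) (sym (ℚ.*-zeroʳ (β′ v))) ⟩
    b * a * (β′ v * 0ℚ)   ∎)
  share-≤ {β′} {a} {b} {v} β′-pos 0≤b β′≤aβ βv≤bβ′v ws@(w ∷ ws′) = begin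
    β v * inv S              ≤⟨ *-monoʳ-≤-nonNeg′ (ℚ.<⇒≤ (inv-pos 0<S)) βv≤bβ′v ⟩
    b * β′ v * inv S         ≤⟨ *-monoˡ-≤-nonNeg′ (*-nonNeg 0≤b (ℚ.<⇒≤ (β′-pos v)))
                                  (inv-antimono {a} 0<S′ 0<S
                                     (sumℚ-≤-scaled {f = β′} {g = β} {c = a} ws β′≤aβ)) ⟩
    b * β′ v * (a * inv S′)  ≡⟨ solve 4 (λ b a x i → b :* x :* (a :* i) := b :* a :* (x :* i))
                                  refl b a (β′ v) (inv S′) ⟩
    b * a * (β′ v * inv S′)  ∎
    where
    S S′ : ℚ
    S = sumℚ (map β ws)
    S′ = sumℚ (map β′ ws)
    0<S : 0ℚ < S
    0<S = sumℚ-pos w ws′ β-pos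
    0<S′ : 0ℚ < S′
    0<S′ = sumℚ-pos w ws′ β′-pos

module _ (I : Instance) where
  open Instance I

  allocOf-nonNeg : ∀ {β} → (∀ w → 0ℚ < β w) → ∀ v → 0ℚ ≤ allocOf I β v
  allocOf-nonNeg β-pos v = sumℚ-nonNeg (NR I v) (λ u → share-nonNeg β-pos v (NL I u))

  allocOf-≤ : ∀ {β β′ a b v} → (∀ w → 0ℚ < β w) → (∀ w → 0ℚ < β′ w) → 0ℚ ≤ b →
              (∀ w → β′ w ≤ a * β w) → β v ≤ b * β′ v →
              allocOf I β v ≤ b * a * allocOf I β′ v
  allocOf-≤ {β} {β′} {a} {b} {v} β-pos β′-pos 0≤b β′≤aβ βv≤bβ′v =
    sumℚ-≤-scaled {f = λ u → xval I β u v} {g = λ u → xval I β′ u v} {c = b * a} (NR I v)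
      (λ u → share-≤ β-pos β′-pos 0≤b β′≤aβ βv≤bβ′v (NL I u))

^-+ : ∀ q m n → q ^ m * q ^ n ≡ q ^ (m ℕ.+ n)
^-+ q zero n = ℚ.*-identityˡ (q ^ n)
^-+ q (suc m) n = trans (ℚ.*-assoc q (q ^ m) (q ^ n)) (cong (q *_) (^-+ q m n))

module _ {q : ℚ} (1<q : 1ℚ < q) where

  ^-pos : ∀ n → 0ℚ < q ^ n
  ^-pos zero = 0<1
  ^-pos (suc n) = *-pos (ℚ.<-trans 0<1 1<q) (^-pos n)

  ^-<-suc : ∀ n → q ^ n < q ^ suc n
  ^-<-suc n = subst (_< q * q ^ n) (ℚ.*-identityˡ (q ^ n))
                (ℚ.*-monoˡ-<-pos (q ^ n) {{positive (^-pos n)}} 1<q)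

  ^-strictMono : ∀ {i j} → i ℕ.< j → q ^ i < q ^ j
  ^-strictMono {i} {suc j} (ℕ.s≤s i≤j) with ℕₚ.m≤n⇒m<n∨m≡n i≤j
  ... | inj₁ i<j = ℚ.<-trans (^-strictMono i<j) (^-<-suc j)
  ... | inj₂ refl = ^-<-suc j

  ^-injective : ∀ {i j} → q ^ i ≡ q ^ j → i ≡ j
  ^-injective {i} {j} qⁱ≡qʲ with ℕₚ.<-cmp i j
  ... | tri< i<j _ _ = ⊥-elim (ℚ.<-irrefl qⁱ≡qʲ (^-strictMono i<j))
  ... | tri≈ _ i≡j _ = i≡j
  ... | tri> _ _ j<i = ⊥-elim (ℚ.<-irrefl (sym qⁱ≡qʲ) (^-strictMono j<i))

approxFactor : ℚ → ℚ → ℚ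
approxFactor k ε = 1ℚ + (k + ι 2) * ε

module _ {k ε : ℚ} where

  private
    split : (1ℚ + k * ε) + (ε + ε) ≡ approxFactor k ε
    split = solve 2 (λ k ε → (con 1ℚ :+ k :* ε) :+ (ε :+ ε)
                           := con 1ℚ :+ (k :+ (con 1ℚ :+ con 1ℚ)) :* ε) refl k ε

  1+kε≤approxFactor : 0ℚ ≤ ε → 1ℚ + k * ε ≤ approxFactor k ε
  1+kε≤approxFactor 0≤ε = begin
    1ℚ + k * ε               ≡⟨ sym (ℚ.+-identityʳ _) ⟩
    (1ℚ + k * ε) + 0ℚ        ≤⟨ ℚ.+-monoʳ-≤ (1ℚ + k * ε) (ℚ.+-mono-≤ 0≤ε 0≤ε) ⟩
    (1ℚ + k * ε) + (ε + ε)   ≡⟨ split ⟩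
    approxFactor k ε         ∎

  [1+ε][1+kε]≤approxFactor : 0ℚ ≤ ε → k * ε ≤ 1ℚ → (1ℚ + ε) * (1ℚ + k * ε) ≤ approxFactor k ε
  [1+ε][1+kε]≤approxFactor 0≤ε kε≤1 = begin
    (1ℚ + ε) * (1ℚ + k * ε)       ≡⟨ solve 2 (λ k ε → (con 1ℚ :+ ε) :* (con 1ℚ :+ k :* ε)
                                        := (con 1ℚ :+ k :* ε) :+ (ε :+ ε :* (k :* ε))) refl k ε ⟩
    (1ℚ + k * ε) + (ε + ε * (k * ε)) ≤⟨ ℚ.+-monoʳ-≤ (1ℚ + k * ε)
                                            (ℚ.+-monoʳ-≤ ε (*-monoˡ-≤-nonNeg′ 0≤ε kε≤1)) ⟩
    (1ℚ + k * ε) + (ε + ε * 1ℚ)   ≡⟨ cong (λ x → (1ℚ + k * ε) + (ε + x)) (ℚ.*-identityʳ ε) ⟩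
    (1ℚ + k * ε) + (ε + ε)        ≡⟨ split ⟩
    approxFactor k ε              ∎

  [1+ε]²≤approxFactor : 0ℚ ≤ ε → ε ≤ k → (1ℚ + ε) * (1ℚ + ε) ≤ approxFactor k ε
  [1+ε]²≤approxFactor 0≤ε ε≤k = begin
    (1ℚ + ε) * (1ℚ + ε)       ≡⟨ solve 1 (λ ε → (con 1ℚ :+ ε) :* (con 1ℚ :+ ε)
                                    := (con 1ℚ :+ ε :* ε) :+ (ε :+ ε)) refl ε ⟩
    (1ℚ + ε * ε) + (ε + ε)    ≤⟨ ℚ.+-monoˡ-≤ (ε + ε) (ℚ.+-monoʳ-≤ 1ℚ (*-monoʳ-≤-nonNeg′ 0≤ε ε≤k)) ⟩
    (1ℚ + k * ε) + (ε + ε)    ≡⟨ split ⟩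
    approxFactor k ε          ∎

module Dynamics (I : Instance) {ε : ℚ} (0<ε : 0ℚ < ε) (kp : Fin (Instance.nR I) → ℕ → ℚ) where
  open Instance I

  q : ℚ
  q = 1ℚ + ε

  0≤ε : 0ℚ ≤ ε
  0≤ε = ℚ.<⇒≤ 0<ε

  1<q : 1ℚ < q
  1<q = 1<1+ 0<ε

  1≤q : 1ℚ ≤ q
  1≤q = ℚ.<⇒≤ 1<q

  0<q : 0ℚ < q
  0<q = ℚ.<-trans 0<1 1<q

  slack : Fin nR → ℕ → ℚ
  slack v r = 1ℚ + kp v r * ε

  data RoundStep (β : Fin nR → ℚ) (r : ℕ) (v : Fin nR) (β′ᵥ : ℚ) : Set where
    raised  : allocOf I β v ≤ ι (C v) * inv (slack v r) →
              β′ᵥ ≡ β v * q → RoundStep β r v β′ᵥ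
    kept    : ι (C v) * inv (slack v r) < allocOf I β v → allocOf I β v < ι (C v) * slack v r →
              β′ᵥ ≡ β v → RoundStep β r v β′ᵥ
    lowered : ι (C v) * inv (slack v r) < allocOf I β v → ι (C v) * slack v r ≤ allocOf I β v →
              β′ᵥ ≡ β v * inv q → RoundStep β r v β′ᵥ

  roundStep : ∀ β r v → RoundStep β r v (update I ε kp r β v)
  -- The with-expressions repeat those of update verbatim, so that update reduces in each branch.
  roundStep β r v with allocOf I β v ℚ.≤? ι (C v) * inv (1ℚ + kp v r * ε)
  ... | yes low = raised low refl
  ... | no ¬low with ι (C v) * (1ℚ + kp v r * ε) ℚ.≤? allocOf I β v
  ...   | yes high = lowered (ℚ.≰⇒> ¬low) high refl
  ...   | no ¬high = kept (ℚ.≰⇒> ¬low) (ℚ.≰⇒> ¬high) refl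

  -- βAfter behind an opaque name: unfolding it exposes the with-clauses of update, whose
  -- normalisation on symbolic rationals exhausts the type checker.
  opaque
    weights : ℕ → Fin nR → ℚ
    weights = βAfter I ε kp

    weights-initial : ∀ v → weights 0 v ≡ 1ℚ
    weights-initial _ = refl

    roundStepAt : ∀ t v → RoundStep (weights t) (suc t) v (weights (suc t) v)
    roundStepAt t = roundStep (weights t) (suc t)

    InLevel⇒weights : ∀ {τ j v} → InLevel I ε kp τ j v → weights τ v ≡ q ^ j * inv (q ^ τ)
    InLevel⇒weights level = level

    allocRound≡allocOf-weights : ∀ m v → allocRound I ε kp (suc m) v ≡ allocOf I (weights m) v
    allocRound≡allocOf-weights _ _ = refl

  module Round {r : ℕ} {β β′ : Fin nR → ℚ} (β-pos : ∀ w → 0ℚ < β w)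
               (step : ∀ w → RoundStep β r w (β′ w)) where

    β′-pos : ∀ w → 0ℚ < β′ w
    β′-pos w with step w
    ... | raised _ e = subst (0ℚ <_) (sym e) (*-pos (β-pos w) 0<q)
    ... | kept _ _ e = subst (0ℚ <_) (sym e) (β-pos w)
    ... | lowered _ _ e = subst (0ℚ <_) (sym e) (*-pos (β-pos w) (inv-pos 0<q))

    β′≤qβ : ∀ w → β′ w ≤ q * β w
    β′≤qβ w with step w
    ... | raised _ e = ℚ.≤-reflexive (trans e (ℚ.*-comm (β w) q))
    ... | kept _ _ e = subst (_≤ q * β w) (sym e) (≤-*-of-1≤ 1≤q (ℚ.<⇒≤ (β-pos w)))
    ... | lowered _ _ e = subst (_≤ q * β w) (sym e) (begin
      β w * inv q  ≤⟨ *-monoˡ-≤-nonNeg′ (ℚ.<⇒≤ (β-pos w)) (inv≤1 1≤q) ⟩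
      β w * 1ℚ     ≡⟨ ℚ.*-identityʳ (β w) ⟩
      β w          ≤⟨ ≤-*-of-1≤ 1≤q (ℚ.<⇒≤ (β-pos w)) ⟩
      q * β w      ∎)

    β≤qβ′ : ∀ w → β w ≤ q * β′ w
    β≤qβ′ w with step w
    ... | raised _ e = begin
      β w       ≤⟨ ≤-*-of-1≤ 1≤q (ℚ.<⇒≤ (β-pos w)) ⟩
      q * β w   ≡⟨ trans (ℚ.*-comm q (β w)) (sym e) ⟩
      β′ w      ≤⟨ ≤-*-of-1≤ 1≤q (ℚ.<⇒≤ (β′-pos w)) ⟩
      q * β′ w  ∎
    ... | kept _ _ e = subst (λ x → β w ≤ q * x) (sym e) (≤-*-of-1≤ 1≤q (ℚ.<⇒≤ (β-pos w)))
    ... | lowered _ _ e = ℚ.≤-reflexive (trans (sym (*-inv-cancel (β w) 0<q)) (cong (q *_) (sym e)))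

    module _ (v : Fin nR) where

      private
        alloc alloc′ : ℚ
        alloc = allocOf I β v
        alloc′ = allocOf I β′ v

      alloc≤alloc′-if-raised : β′ v ≡ β v * q → alloc ≤ alloc′
      alloc≤alloc′-if-raised e = begin
        alloc               ≤⟨ allocOf-≤ I β-pos β′-pos (ℚ.<⇒≤ (inv-pos 0<q)) β′≤qβ
                                 (ℚ.≤-reflexive (trans (sym (inv-*-cancel (β v) 0<q))
                                                       (cong (inv q *_) (sym e)))) ⟩
        inv q * q * alloc′  ≡⟨ cong (_* alloc′) (inv-inverseˡ 0<q) ⟩
        1ℚ * alloc′         ≡⟨ ℚ.*-identityˡ alloc′ ⟩
        alloc′              ∎

      alloc′≤alloc-if-lowered : β′ v ≡ β v * inv q → alloc′ ≤ alloc
      alloc′≤alloc-if-lowered e = begin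
        alloc′              ≤⟨ allocOf-≤ I β′-pos β-pos (ℚ.<⇒≤ (inv-pos 0<q)) β≤qβ′
                                 (ℚ.≤-reflexive (trans e (ℚ.*-comm (β v) (inv q)))) ⟩
        inv q * q * alloc   ≡⟨ cong (_* alloc) (inv-inverseˡ 0<q) ⟩
        1ℚ * alloc          ≡⟨ ℚ.*-identityˡ alloc ⟩
        alloc               ∎

      alloc≤q*alloc′-if-kept : β′ v ≡ β v → alloc ≤ q * alloc′
      alloc≤q*alloc′-if-kept e = begin
        alloc              ≤⟨ allocOf-≤ I {a = q} β-pos β′-pos (ℚ.<⇒≤ 0<1) β′≤qβ
                                (ℚ.≤-reflexive (trans (sym e) (sym (ℚ.*-identityˡ (β′ v))))) ⟩
        1ℚ * q * alloc′    ≡⟨ cong (_* alloc′) (ℚ.*-identityˡ q) ⟩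
        q * alloc′         ∎

      alloc′≤q*alloc-if-kept : β′ v ≡ β v → alloc′ ≤ q * alloc
      alloc′≤q*alloc-if-kept e = begin
        alloc′             ≤⟨ allocOf-≤ I {a = q} β′-pos β-pos (ℚ.<⇒≤ 0<1) β≤qβ′
                                (ℚ.≤-reflexive (trans e (sym (ℚ.*-identityˡ (β v))))) ⟩
        1ℚ * q * alloc     ≡⟨ cong (_* alloc) (ℚ.*-identityˡ q) ⟩
        q * alloc          ∎

      alloc≤q²*alloc′ : alloc ≤ q * q * alloc′
      alloc≤q²*alloc′ = allocOf-≤ I β-pos β′-pos (ℚ.<⇒≤ 0<q) β′≤qβ (β≤qβ′ v)

      alloc′≤q²*alloc : alloc′ ≤ q * q * alloc
      alloc′≤q²*alloc = allocOf-≤ I β′-pos β-pos (ℚ.<⇒≤ 0<q) β≤qβ′ (β′≤qβ v)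

  weights-pos : ∀ t w → 0ℚ < weights t w
  weights-pos zero w = subst (0ℚ <_) (sym (weights-initial w)) 0<1
  weights-pos (suc t) = Round.β′-pos (weights-pos t) (roundStepAt t)

  module _ {τ j : ℕ} {v : Fin nR} where

    InLevel-scaled : InLevel I ε kp τ j v → weights τ v * q ^ τ ≡ q ^ j
    InLevel-scaled level = begin-equality
      weights τ v * q ^ τ            ≡⟨ cong (_* q ^ τ) (InLevel⇒weights {τ} {j} {v} level) ⟩
      q ^ j * inv (q ^ τ) * q ^ τ    ≡⟨ ℚ.*-assoc (q ^ j) (inv (q ^ τ)) (q ^ τ) ⟩
      q ^ j * (inv (q ^ τ) * q ^ τ)  ≡⟨ cong (q ^ j *_) (inv-inverseˡ (^-pos 1<q τ)) ⟩
      q ^ j * 1ℚ                     ≡⟨ ℚ.*-identityʳ (q ^ j) ⟩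
      q ^ j                          ∎

    InLevel-top : weights τ v ≡ q ^ τ → InLevel I ε kp τ j v → j ≡ 2 ℕ.* τ
    InLevel-top top level = sym (^-injective 1<q (begin-equality
      q ^ (2 ℕ.* τ)              ≡⟨ cong (λ n → q ^ (τ ℕ.+ n)) (ℕₚ.+-identityʳ τ) ⟩
      q ^ (τ ℕ.+ τ)              ≡⟨ sym (^-+ q τ τ) ⟩
      q ^ τ * q ^ τ              ≡⟨ cong (_* q ^ τ) (sym top) ⟩
      weights τ v * q ^ τ        ≡⟨ InLevel-scaled level ⟩
      q ^ j                      ∎))

    InLevel-bottom : weights τ v * q ^ τ ≡ 1ℚ → InLevel I ε kp τ j v → j ≡ 0
    InLevel-bottom bottom level = ^-injective 1<q (trans (sym (InLevel-scaled level)) bottom)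

  module Bounds {k : ℚ} (ε≤k : ε ≤ k) (kε≤1 : k * ε ≤ 1ℚ) (v : Fin nR) {τ : ℕ}
                (kp-range : ∀ t → t ℕ.< τ → 0ℚ ≤ kp v (suc t) × kp v (suc t) ≤ k) where

    private
      β : ℕ → Fin nR → ℚ
      β = weights

      module Step (t : ℕ) = Round (weights-pos t) (roundStepAt t)

      c D : ℚ
      c = ι (C v)
      D = approxFactor k ε

      alloc : ℕ → ℚ
      alloc t = allocOf I (β t) v

      s : ℕ → ℚ
      s t = slack v (suc t)

      0≤c : 0ℚ ≤ c
      0≤c = ℚ.nonNegative⁻¹ c {{ℚ.normalize-nonNeg (C v) 1}}

      0≤alloc : ∀ t → 0ℚ ≤ alloc t
      0≤alloc t = allocOf-nonNeg I (weights-pos t) v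

      1+kε≤D : 1ℚ + k * ε ≤ D
      1+kε≤D = 1+kε≤approxFactor {k} 0≤ε

      1≤D : 1ℚ ≤ D
      1≤D = ℚ.≤-trans (1≤1+ (*-nonNeg (ℚ.≤-trans 0≤ε ε≤k) 0≤ε)) 1+kε≤D

      0<D : 0ℚ < D
      0<D = ℚ.<-≤-trans 0<1 1≤D

      q²≤D : q * q ≤ D
      q²≤D = [1+ε]²≤approxFactor 0≤ε ε≤k

      1≤s : ∀ {t} → t ℕ.< τ → 1ℚ ≤ s t
      1≤s t<τ = 1≤1+ (*-nonNeg (proj₁ (kp-range _ t<τ)) 0≤ε)

      0<s : ∀ {t} → t ℕ.< τ → 0ℚ < s t
      0<s t<τ = ℚ.<-≤-trans 0<1 (1≤s t<τ)

      s≤1+kε : ∀ {t} → t ℕ.< τ → s t ≤ 1ℚ + k * ε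
      s≤1+kε t<τ = ℚ.+-monoʳ-≤ 1ℚ (*-monoʳ-≤-nonNeg′ 0≤ε (proj₂ (kp-range _ t<τ)))

      q*s≤D : ∀ {t} → t ℕ.< τ → q * s t ≤ D
      q*s≤D t<τ = ℚ.≤-trans (*-monoˡ-≤-nonNeg′ (ℚ.<⇒≤ 0<q) (s≤1+kε t<τ))
                            ([1+ε][1+kε]≤approxFactor {k} 0≤ε kε≤1)

      c≤D*alloc-if-not-raised : ∀ {t} → t ℕ.< τ → c * inv (s t) < alloc t → c ≤ D * alloc t
      c≤D*alloc-if-not-raised {t} t<τ c/s<alloc = begin
        c            ≤⟨ *-inv-<⇒≤-* (0<s t<τ) c/s<alloc ⟩
        s t * alloc t ≤⟨ *-monoʳ-≤-nonNeg′ (0≤alloc t) (ℚ.≤-trans (s≤1+kε t<τ) 1+kε≤D) ⟩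
        D * alloc t   ∎

      c/s≤c : ∀ {t} → t ℕ.< τ → c * inv (s t) ≤ c
      c/s≤c {t} t<τ = subst (c * inv (s t) ≤_) (ℚ.*-identityʳ c)
                            (*-monoˡ-≤-nonNeg′ 0≤c (inv≤1 (1≤s t<τ)))

      always-raised : ∀ {t} → β (suc t) v ≡ β t v * q → β t v ≡ q ^ t → β (suc t) v ≡ q ^ suc t
      always-raised {t} raise top = trans raise (trans (cong (_* q) top) (ℚ.*-comm (q ^ t) q))

      always-lowered : ∀ {t} → β (suc t) v ≡ β t v * inv q → β t v * q ^ t ≡ 1ℚ →
                       β (suc t) v * q ^ suc t ≡ 1ℚ
      always-lowered {t} lower bottom = begin-equality
        β (suc t) v * (q * q ^ t)      ≡⟨ cong (_* (q * q ^ t)) lower ⟩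
        β t v * inv q * (q * q ^ t)    ≡⟨ solve 4 (λ b q⁻¹ q qᵗ → b :* q⁻¹ :* (q :* qᵗ)
                                                             := b :* qᵗ :* (q⁻¹ :* q))
                                            refl (β t v) (inv q) q (q ^ t) ⟩
        β t v * q ^ t * (inv q * q)    ≡⟨ cong₂ _*_ bottom (inv-inverseˡ 0<q) ⟩
        1ℚ                             ∎

    lower-invariant : ∀ t → t ℕ.≤ τ → β t v ≡ q ^ t ⊎ c ≤ D * alloc t
    lower-invariant zero _ = inj₁ (weights-initial v)
    lower-invariant (suc t) t<τ with roundStepAt t v | lower-invariant t (ℕₚ.<⇒≤ t<τ)
    ... | raised _ raise | inj₁ top = inj₁ (always-raised raise top)
    ... | raised _ raise | inj₂ c≤D*alloc =
      inj₂ (ℚ.≤-trans c≤D*alloc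
              (*-monoˡ-≤-nonNeg′ (ℚ.<⇒≤ 0<D) (Step.alloc≤alloc′-if-raised t v raise)))
    ... | kept c/s<alloc _ keep | _ = inj₂ (begin
      c                             ≤⟨ *-inv-<⇒≤-* (0<s t<τ) c/s<alloc ⟩
      s t * alloc t                 ≤⟨ *-monoˡ-≤-nonNeg′ (ℚ.<⇒≤ (0<s t<τ))
                                         (Step.alloc≤q*alloc′-if-kept t v keep) ⟩
      s t * (q * alloc (suc t))     ≡⟨ solve 3 (λ s q a → s :* (q :* a) := q :* s :* a)
                                         refl (s t) q (alloc (suc t)) ⟩
      q * s t * alloc (suc t)       ≤⟨ *-monoʳ-≤-nonNeg′ (0≤alloc (suc t)) (q*s≤D t<τ) ⟩
      D * alloc (suc t)             ∎)
    ... | lowered _ c*s≤alloc _ | _ = inj₂ (begin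
      c                    ≤⟨ ≤-*-of-1≤ (1≤s t<τ) 0≤c ⟩
      s t * c              ≡⟨ ℚ.*-comm (s t) c ⟩
      c * s t              ≤⟨ c*s≤alloc ⟩
      alloc t              ≤⟨ Step.alloc≤q²*alloc′ t v ⟩
      q * q * alloc (suc t) ≤⟨ *-monoʳ-≤-nonNeg′ (0≤alloc (suc t)) q²≤D ⟩
      D * alloc (suc t)    ∎)

    upper-invariant : ∀ t → t ℕ.≤ τ → β t v * q ^ t ≡ 1ℚ ⊎ alloc t ≤ D * c
    upper-invariant zero _ = inj₁ (cong (_* 1ℚ) (weights-initial v))
    upper-invariant (suc t) t<τ with roundStepAt t v | upper-invariant t (ℕₚ.<⇒≤ t<τ)
    ... | lowered _ _ lower | inj₁ bottom = inj₁ (always-lowered lower bottom)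
    ... | lowered _ _ lower | inj₂ alloc≤D*c =
      inj₂ (ℚ.≤-trans (Step.alloc′≤alloc-if-lowered t v lower) alloc≤D*c)
    ... | kept _ alloc<c*s keep | _ = inj₂ (begin
      alloc (suc t)    ≤⟨ Step.alloc′≤q*alloc-if-kept t v keep ⟩
      q * alloc t      ≤⟨ *-monoˡ-≤-nonNeg′ (ℚ.<⇒≤ 0<q) (ℚ.<⇒≤ alloc<c*s) ⟩
      q * (c * s t)    ≡⟨ solve 3 (λ q c s → q :* (c :* s) := q :* s :* c) refl q c (s t) ⟩
      q * s t * c      ≤⟨ *-monoʳ-≤-nonNeg′ 0≤c (q*s≤D t<τ) ⟩
      D * c            ∎)
    ... | raised alloc≤c/s _ | _ = inj₂ (begin
      alloc (suc t)    ≤⟨ Step.alloc′≤q²*alloc t v ⟩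
      q * q * alloc t  ≤⟨ *-monoˡ-≤-nonNeg′ (ℚ.<⇒≤ (*-pos 0<q 0<q))
                            (ℚ.≤-trans alloc≤c/s (c/s≤c t<τ)) ⟩
      q * q * c        ≤⟨ *-monoʳ-≤-nonNeg′ 0≤c q²≤D ⟩
      D * c            ∎)

    allocRound-lower : ∀ m j → m ℕ.< τ → j ℕ.< 2 ℕ.* suc m → InLevel I ε kp (suc m) j v →
                       inv D * c ≤ allocRound I ε kp (suc m) v
    allocRound-lower m j m<τ j<2τ level =
      subst (inv D * c ≤_) (sym (allocRound≡allocOf-weights m v)) (≤-*⇒inv-*≤ 0<D c≤D*alloc)
      where
      c≤D*alloc : c ≤ D * alloc m
      c≤D*alloc with roundStepAt m v | lower-invariant m (ℕₚ.<⇒≤ m<τ)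
      ... | raised _ raise | inj₁ top =
        ⊥-elim (ℕₚ.<-irrefl (InLevel-top (always-raised raise top) level) j<2τ)
      ... | raised _ _ | inj₂ c≤D*alloc = c≤D*alloc
      ... | kept c/s<alloc _ _ | _ = c≤D*alloc-if-not-raised m<τ c/s<alloc
      ... | lowered c/s<alloc _ _ | _ = c≤D*alloc-if-not-raised m<τ c/s<alloc

    allocRound-upper : ∀ m j → m ℕ.< τ → 1 ℕ.≤ j → InLevel I ε kp (suc m) j v →
                       allocRound I ε kp (suc m) v ≤ D * c
    allocRound-upper m j m<τ 1≤j level =
      subst (_≤ D * c) (sym (allocRound≡allocOf-weights m v)) alloc≤D*c
      where
      alloc≤D*c : alloc m ≤ D * c
      alloc≤D*c with roundStepAt m v | upper-invariant m (ℕₚ.<⇒≤ m<τ)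
      ... | lowered _ _ lower | inj₁ bottom =
        ⊥-elim (ℕₚ.<⇒≢ 1≤j (sym (InLevel-bottom (always-lowered lower bottom) level)))
      ... | lowered _ _ _ | inj₂ alloc≤D*c = alloc≤D*c
      ... | kept _ alloc<c*s _ | _ = begin
        alloc m   ≤⟨ ℚ.<⇒≤ alloc<c*s ⟩
        c * s m   ≤⟨ *-monoˡ-≤-nonNeg′ 0≤c (ℚ.≤-trans (s≤1+kε m<τ) 1+kε≤D) ⟩
        c * D     ≡⟨ ℚ.*-comm c D ⟩
        D * c     ∎
      ... | raised alloc≤c/s _ | _ = begin
        alloc m           ≤⟨ alloc≤c/s ⟩
        c * inv (s m)     ≤⟨ c/s≤c m<τ ⟩
        c                 ≤⟨ ≤-*-of-1≤ 1≤D 0≤c ⟩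
        D * c             ∎

lemma6 : (I : Instance) → (∀ v → 1 ℕ.≤ Instance.C I v) →
    (τ : ℕ) → 1 ℕ.≤ τ →
    (ε : ℚ) → 0ℚ < ε → ε ≤ (+ 1) / 4 →
    (kp : Fin (Instance.nR I) → ℕ → ℚ) →
    (∀ v r → 1 ℕ.≤ r → r ℕ.≤ τ → 0ℚ < kp v r) →
    (k : ℚ) → 0ℚ < k → ε ≤ inv k →
    (∀ v r → 1 ℕ.≤ r → r ℕ.≤ τ → (inv k ≤ kp v r) × (kp v r ≤ k)) →
    (∀ v j → j ℕ.< 2 ℕ.* τ → InLevel I ε kp τ j v →
      inv (1ℚ + (k + ι 2) * ε) * ι (Instance.C I v) ≤ allocRound I ε kp τ v)
    ×
    (∀ v j → 1 ℕ.≤ j → j ℕ.≤ 2 ℕ.* τ → InLevel I ε kp τ j v →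
      allocRound I ε kp τ v ≤ (1ℚ + (k + ι 2) * ε) * ι (Instance.C I v))
lemma6 I _ zero () _
lemma6 I _ (suc m) _ ε 0<ε _ kp kp-pos k 0<k ε≤1/k kp-range =
    (λ v j j<2τ level → Bounds.allocRound-lower (ε≤k v) kε≤1 v (range v) m j ℕₚ.≤-refl j<2τ level)
  , (λ v j 1≤j _ level → Bounds.allocRound-upper (ε≤k v) kε≤1 v (range v) m j ℕₚ.≤-refl 1≤j level)
  where
  open Dynamics I 0<ε kp

  kε≤1 : k * ε ≤ 1ℚ
  kε≤1 = ℚ.≤-trans (*-monoˡ-≤-nonNeg′ (ℚ.<⇒≤ 0<k) ε≤1/k) (ℚ.≤-reflexive (inv-inverseʳ 0<k))

  range : ∀ v t → t ℕ.< suc m → 0ℚ ≤ kp v (suc t) × kp v (suc t) ≤ k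
  range v t t<τ = ℚ.<⇒≤ (kp-pos v (suc t) (ℕ.s≤s ℕ.z≤n) t<τ)
                , proj₂ (kp-range v (suc t) (ℕ.s≤s ℕ.z≤n) t<τ)

  ε≤k : ∀ v → ε ≤ k
  ε≤k v = ℚ.≤-trans ε≤1/k (ℚ.≤-trans (proj₁ first-round) (proj₂ first-round))
    where
    first-round : (inv k ≤ kp v 1) × (kp v 1 ≤ k)
    first-round = kp-range v 1 ℕₚ.≤-refl (ℕ.s≤s ℕ.z≤n)
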